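{- For every integer $k\ge 3$ there exists a graph $G$ with chromatic number $k$ satisfying $\chi_\ell(G) > \chi(G) = \frac{1}{2}\Delta(G)+1$.
   Context: $\chi(G)$ is the chromatic number, $\Delta(G)$ the maximum degree, and $\chi_\ell(G)$ the list chromatic number: the minimum $k$ such that for every assignment of lists of $k$ colors to the vertices there is a proper coloring choosing each vertex's color from its list. -}

module Defs where

open import Data.Nat using (ℕ; zero; suc; _⊔_; _≤_; _<_)
open import Data.Bool using (Bool; true; false)
open import Data.Fin using (Fin)
open import Data.List using (List; length; filterᵇ; allFin; foldr; map)
open import Data.List.Membership.Propositional using (_∈_)
open import Data.List.Relation.Unary.Unique.Propositional using (Unique)
open import Data.Product using (Σ; _×_)
open import Relation.Binary.PropositionalEquality using (_≡_; _≢_)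

record Graph : Set where
  field
    n     : ℕ
    adj   : Fin n → Fin n → Bool
    sym   : ∀ u v → adj u v ≡ adj v u
    irrefl : ∀ v → adj v v ≡ false
open Graph public

degree : (G : Graph) → Fin (n G) → ℕ
degree G v = length (filterᵇ (adj G v) (allFin (n G)))

Δ : Graph → ℕ
Δ G = foldr _⊔_ 0 (map (degree G) (allFin (n G)))

Proper : {C : Set} (G : Graph) → (Fin (n G) → C) → Set
Proper G c = ∀ u v → adj G u v ≡ true → c u ≢ c v

Colorable : Graph → ℕ → Set
Colorable G k = Σ (Fin (n G) → Fin k) (Proper G)

IsChromaticNumber : Graph → ℕ → Set
IsChromaticNumber G k = Colorable G k × (∀ m → Colorable G m → k ≤ m)

ListAssignment : Graph → ℕ → Set
ListAssignment G k =
  Σ (Fin (n G) → List ℕ) (λ L → ∀ v → Unique (L v) × length (L v) ≡ k)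

Choosable : Graph → ℕ → Set
Choosable G k = (L : ListAssignment G k) →
  Σ (Fin (n G) → ℕ) (λ c → Proper G c × (∀ v → c v ∈ Data.Product.proj₁ L v))

-- A k-clique bounds both χ and χ_ℓ below by k, so it suffices to exhibit a k-clique, a k-colouring
-- and an assignment of k-lists admitting no colouring, in a graph of maximum degree 2k − 2.
-- The key fact: a q-clique coloured from a window of q + 1 colours misses exactly one of them, so
-- every common neighbour of the clique that is coloured from the same window gets that colour.
-- For k ≥ 4 take disjoint (k − 1)-cliques S and T and an independent set R of k vertices joined to
-- all of S ∪ T; the graph is (2k − 2)-regular.  With lists [0, k) on S and [k, 2k) on T, the
-- R-vertices coloured below k all share one colour a, and those coloured in [k, 2k) one colour b.
-- Two R-lists lie in [2, 2k) and meet [k, 2k) in disjoint sets, so one of them is coloured a, and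
-- a ≥ 2.  The other k − 2 R-lists meet [0, k) only in {0, 1}, hence are all coloured b, yet each
-- misses a pair {k + m, k + m + 1}, and these pairs cover [k, 2k).  For k = 3 the same argument
-- runs on a 4-regular graph on 21 vertices: the cliques become the edges of two copies of a small
-- gadget, and five connector lists rule out every pair (a, b).

module Submission where

open import Defs hiding (sym)
open import Data.Nat using (ℕ; zero; suc; _+_; _∸_; _*_; _≤_; _<_; _⊔_; _≡ᵇ_; z≤n; s≤s)
import Data.Nat.Properties as ℕ
open import Data.Nat.Properties
  using (∸-monoˡ-<; ∸-cancelʳ-≡; m+n∸m≡n; m+[n∸m]≡n; ≤∧≢⇒<; n≮n; ⊔-identityʳ; ⊔-idem; <⇒≢; <⇒≱;
         <-≤-connex; ≤-refl; ≤-trans; ≤-reflexive; <-trans; <-≤-trans; m≤m+n; m≤n+m; +-suc; +-comm;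
         +-assoc; +-identityʳ; +-monoʳ-<; +-monoʳ-≤; +-monoˡ-≤)
open import Data.Bool using (Bool; true; false; not; _∧_; _∨_; if_then_else_)
open import Data.Bool.Properties using (∨-comm)
import Data.Bool.Properties as Bool
open import Data.Bool.ListAction using (any)
open import Data.Fin using (Fin; zero; suc; toℕ; fromℕ; fromℕ<; #_; _↑ˡ_; _↑ʳ_; splitAt; combine; remQuot)
open import Data.Fin.Properties
  using (_≟_; all?; any?; injective⇒≤; toℕ-fromℕ<; toℕ-fromℕ; toℕ-injective; toℕ<n; suc-injective;
         splitAt-↑ˡ; splitAt-↑ʳ)
open import Data.Vec.Functional using (Vector) renaming (_∷_ to _◂_)
open import Data.List
  using (List; []; _∷_; _++_; length; filterᵇ; tabulate; applyUpTo; upTo; foldr; map; concatMap; allFin)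
open import Data.List.Properties using (length-applyUpTo; length-upTo; length-++)
open import Data.List.Membership.Propositional using (_∈_; _∉_)
open import Data.List.Membership.Propositional.Properties using (∈-upTo⁻; ∈-applyUpTo⁻; ∈-++⁻)
open import Data.List.Membership.DecPropositional ℕ._≟_ using (_∈?_)
import Data.List.Relation.Unary.All as All
open import Data.List.Relation.Unary.Unique.Propositional using (Unique)
open import Data.List.Relation.Unary.Unique.Propositional.Properties using (upTo⁺; applyUpTo⁺₁; ++⁺)
open import Data.List.Relation.Unary.Unique.DecPropositional ℕ._≟_ using (unique?)
open import Data.Product using (Σ; _×_; _,_; proj₁; proj₂; map₂)
open import Data.Sum using (_⊎_; inj₁; inj₂; [_,_]′)
open import Data.Empty using (⊥; ⊥-elim)
open import Function using (_∘_; Injective; mk⇔)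
open import Relation.Nullary using (¬_; ¬?; Dec; yes; no; does)
open import Relation.Nullary.Decidable using (dec-true; dec-false; does-⇔; from-yes; _×-dec_; _→-dec_)
open import Relation.Binary.PropositionalEquality
  using (_≡_; _≢_; refl; sym; trans; cong; cong₂; subst; _≗_; module ≡-Reasoning)

IsClique : (G : Graph) {m : ℕ} → (Fin m → Fin (n G)) → Set
IsClique G w = ∀ i j → i ≢ j → adj G (w i) (w j) ≡ true

InWindow : ℕ → ℕ → ℕ → Set
InWindow o m x = o ≤ x × x < o + m

injective-in-window⇒≤ : ∀ {k} o m (g : Fin k → ℕ) → Injective _≡_ _≡_ g →
                         (∀ i → InWindow o m (g i)) → k ≤ m
injective-in-window⇒≤ {k} o m g g-inj window = injective⇒≤ slot-inj
  where
  offset< : ∀ i → g i ∸ o < m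
  offset< i with window i
  ... | o≤g , g<o+m = ≤-trans (∸-monoˡ-< g<o+m o≤g) (≤-reflexive (m+n∸m≡n o m))
  slot : Fin k → Fin m
  slot i = fromℕ< (offset< i)
  slot-inj : Injective _≡_ _≡_ slot
  slot-inj {i} {j} e = g-inj (∸-cancelʳ-≡ (proj₁ (window i)) (proj₁ (window j))
    (trans (sym (toℕ-fromℕ< (offset< i))) (trans (cong toℕ e) (toℕ-fromℕ< (offset< j)))))

injective-◂ : ∀ {A : Set} {m} {a : A} {g : Vector A m} →
              (∀ i → a ≢ g i) → Injective _≡_ _≡_ g → Injective _≡_ _≡_ (a ◂ g)
injective-◂ _     _     {zero}  {zero}  _ = refl
injective-◂ fresh _     {zero}  {suc j} e = ⊥-elim (fresh j e)
injective-◂ fresh _     {suc i} {zero}  e = ⊥-elim (fresh i (sym e))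
injective-◂ _     g-inj {suc i} {suc j} e = cong suc (g-inj e)

proper-clique⇒injective : (G : Graph) {C : Set} {c : Fin (n G) → C} → Proper G c →
                          ∀ {m} {w : Fin m → Fin (n G)} → IsClique G w → Injective _≡_ _≡_ (c ∘ w)
proper-clique⇒injective G proper {w = w} clique {i} {j} e with i ≟ j
... | yes i≡j = i≡j
... | no i≢j = ⊥-elim (proper (w i) (w j) (clique i j i≢j) e)

-- The clique together with x and y would need q + 2 distinct colours from a window of q + 1.
common-neighbours-of-clique-agree :
  (G : Graph) {c : Fin (n G) → ℕ} → Proper G c →
  ∀ {q o} {w : Fin q → Fin (n G)} → IsClique G w → (∀ i → InWindow o (suc q) (c (w i))) →
  ∀ {x y} → (∀ i → adj G x (w i) ≡ true) → (∀ i → adj G y (w i) ≡ true) →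
  InWindow o (suc q) (c x) → InWindow o (suc q) (c y) → c x ≡ c y
common-neighbours-of-clique-agree G {c} proper {q} {o} {w} clique w-window {x} {y} x~w y~w x-window y-window
  with c x ℕ.≟ c y
... | yes cx≡cy = cx≡cy
... | no cx≢cy = ⊥-elim (n≮n (suc q) (injective-in-window⇒≤ o (suc q) colours colours-inj window))
  where
  colours : Vector ℕ (suc (suc q))
  colours = c x ◂ (c y ◂ (c ∘ w))
  colours-inj : Injective _≡_ _≡_ colours
  colours-inj = injective-◂ (λ { zero → cx≢cy ; (suc i) → proper x (w i) (x~w i) })
                  (injective-◂ (λ i → proper y (w i) (y~w i)) (proper-clique⇒injective G proper clique))
  window : ∀ i → InWindow o (suc q) (colours i)
  window zero = x-window
  window (suc zero) = y-window
  window (suc (suc i)) = w-window i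

colourable⇒clique≤ : (G : Graph) {k m : ℕ} {w : Fin k → Fin (n G)} →
                     IsClique G w → Colorable G m → k ≤ m
colourable⇒clique≤ G {m = m} {w} clique (c , proper) =
  injective-in-window⇒≤ 0 m (toℕ ∘ c ∘ w)
    (proper-clique⇒injective G proper clique ∘ toℕ-injective) (λ i → z≤n , toℕ<n (c (w i)))

ListColouring : (G : Graph) {k : ℕ} → ListAssignment G k → Set
ListColouring G L = Σ (Fin (n G) → ℕ) (λ c → Proper G c × (∀ v → c v ∈ proj₁ L v))

choosable⇒clique≤ : (G : Graph) {k m : ℕ} {w : Fin k → Fin (n G)} →
                    IsClique G w → Choosable G m → k ≤ m
choosable⇒clique≤ G {m = m} {w} clique choosable
  with choosable ((λ _ → upTo m) , (λ _ → upTo⁺ m , length-upTo m))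
... | c , proper , c∈L =
  injective-in-window⇒≤ 0 m (c ∘ w) (proper-clique⇒injective G proper clique)
    (λ i → z≤n , ∈-upTo⁻ (c∈L (w i)))

clique-bad-lists⇒choosability> : (G : Graph) {k m : ℕ} {w : Fin k → Fin (n G)} → IsClique G w →
                                  (L : ListAssignment G k) → ¬ ListColouring G L → Choosable G m → k < m
clique-bad-lists⇒choosability> G clique L no-colouring choosable =
  ≤∧≢⇒< (choosable⇒clique≤ G clique choosable) λ { refl → no-colouring (choosable L) }

record Witness (k : ℕ) : Set where
  field
    graph           : Graph
    clique          : Fin k → Fin (n graph)
    isClique        : IsClique graph clique
    colouring       : Colorable graph k
    lists           : ListAssignment graph k
    noListColouring : ¬ ListColouring graph lists
    maxDegree       : Δ graph ≡ 2 * (k ∸ 1)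

witness⇒choosability-gap : ∀ {k} → Witness k →
  Σ Graph (λ G → IsChromaticNumber G k × (∀ m → Choosable G m → k < m) × Δ G ≡ 2 * (k ∸ 1))
witness⇒choosability-gap W = graph , (colouring , λ m → colourable⇒clique≤ graph isClique)
                                   , (λ m → clique-bad-lists⇒choosability> graph isClique lists noListColouring)
                                   , maxDegree
  where open Witness W

trues : ∀ {m} → (Fin m → Bool) → ℕ
trues {zero}  p = 0
trues {suc m} p = if p zero then suc (trues (p ∘ suc)) else trues (p ∘ suc)

length-filter-tabulate : ∀ {A : Set} {m} (p : A → Bool) (f : Fin m → A) →
                         length (filterᵇ p (tabulate f)) ≡ trues (p ∘ f)
length-filter-tabulate {m = zero}  p f = refl
length-filter-tabulate {m = suc m} p f with p (f zero)
... | true  = cong suc (length-filter-tabulate p (f ∘ suc))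
... | false = length-filter-tabulate p (f ∘ suc)

trues-↑ : ∀ m {n} (p : Fin (m + n) → Bool) → trues p ≡ trues (p ∘ (_↑ˡ n)) + trues (p ∘ (m ↑ʳ_))
trues-↑ zero    p = refl
trues-↑ (suc m) p with p zero
... | true  = cong suc (trues-↑ m (p ∘ suc))
... | false = trues-↑ m (p ∘ suc)

trues-cong : ∀ {m} {p p′ : Fin m → Bool} → p ≗ p′ → trues p ≡ trues p′
trues-cong {zero}  e = refl
trues-cong {suc m} {p} {p′} e with p zero | p′ zero | e zero
... | true  | true  | refl = cong suc (trues-cong (e ∘ suc))
... | false | false | refl = trues-cong (e ∘ suc)

trues-true : ∀ m → trues {m} (λ _ → true) ≡ m
trues-true zero    = refl
trues-true (suc m) = cong suc (trues-true m)

trues-false : ∀ m → trues {m} (λ _ → false) ≡ 0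
trues-false zero    = refl
trues-false (suc m) = trues-false m

trues-≢ : ∀ {m} (i : Fin (suc m)) → trues (λ j → not (does (i ≟ j))) ≡ m
trues-≢ {m} zero = trues-true m
trues-≢ {suc m} (suc i) = cong suc (trues-≢ i)

foldr-⊔-constant : ∀ {A : Set} (f : A → ℕ) {d} x xs → (∀ y → f y ≡ d) →
                   foldr _⊔_ 0 (map f (x ∷ xs)) ≡ d
foldr-⊔-constant f x []       f≡d = trans (⊔-identityʳ (f x)) (f≡d x)
foldr-⊔-constant f x (y ∷ xs) f≡d = trans (cong₂ _⊔_ (f≡d x) (foldr-⊔-constant f y xs f≡d)) (⊔-idem _)

range : ℕ → ℕ → List ℕ
range a m = applyUpTo (a +_) m

∈-range⁻ : ∀ {a m x} → x ∈ range a m → InWindow a m x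
∈-range⁻ {a} x∈ with ∈-applyUpTo⁻ (a +_) x∈
... | i , i<m , refl = m≤m+n a i , +-monoʳ-< a i<m

UniqueOfLength : ℕ → List ℕ → Set
UniqueOfLength m xs = Unique xs × length xs ≡ m

range-uniqueOfLength : ∀ a m → UniqueOfLength m (range a m)
range-uniqueOfLength a m =
  applyUpTo⁺₁ (a +_) m (λ i<j _ → <⇒≢ (+-monoʳ-< a i<j)) , length-applyUpTo (a +_) m

++-uniqueOfLength : ∀ {xs ys l m} b → UniqueOfLength l xs → UniqueOfLength m ys →
                    (∀ {x} → x ∈ xs → x < b) → (∀ {y} → y ∈ ys → b ≤ y) →
                    UniqueOfLength (l + m) (xs ++ ys)
++-uniqueOfLength {xs} b (xs-unique , refl) (ys-unique , refl) below above =
  ++⁺ xs-unique ys-unique (λ (x∈xs , x∈ys) → <⇒≱ (below x∈xs) (above x∈ys)) , length-++ xs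

module Construction3 where

  gadget : List (ℕ × ℕ)
  gadget = (0 , 1) ∷ (2 , 3) ∷ (4 , 5)
         ∷ (6 , 0) ∷ (6 , 1) ∷ (6 , 2) ∷ (6 , 3)
         ∷ (7 , 2) ∷ (7 , 3) ∷ (7 , 4) ∷ (7 , 5) ∷ []

  sEnd tEnd : Fin 3 → Fin 2 → Fin 21
  sEnd e b = combine e b ↑ˡ 15
  tEnd e b = 8 ↑ʳ (combine e b ↑ˡ 7)

  connector : Fin 5 → Fin 21
  connector i = 16 ↑ʳ i

  attachment : Fin 5 → Fin 3 × Fin 3
  attachment zero                         = # 0 , # 0
  attachment (suc zero)                   = # 0 , # 2
  attachment (suc (suc zero))             = # 1 , # 0
  attachment (suc (suc (suc zero)))       = # 2 , # 2
  attachment (suc (suc (suc (suc zero)))) = # 2 , # 1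

  connectorList : Fin 5 → List ℕ
  connectorList zero                         = 1 ∷ 2 ∷ 5 ∷ []
  connectorList (suc zero)                   = 2 ∷ 3 ∷ 4 ∷ []
  connectorList (suc (suc zero))             = 0 ∷ 2 ∷ 5 ∷ []
  connectorList (suc (suc (suc zero)))       = 0 ∷ 1 ∷ 5 ∷ []
  connectorList (suc (suc (suc (suc zero)))) = 0 ∷ 1 ∷ 3 ∷ []

  attachedTo : Fin 5 → List (Fin 21)
  attachedTo i = sEnd s zero ∷ sEnd s (suc zero) ∷ tEnd t zero ∷ tEnd t (suc zero) ∷ []
    where
    s t : Fin 3
    s = proj₁ (attachment i)
    t = proj₂ (attachment i)

  edges : List (ℕ × ℕ)
  edges = gadget ++ map (λ (a , b) → 8 + a , 8 + b) gadget
                 ++ concatMap (λ i → map (λ v → toℕ (connector i) , toℕ v) (attachedTo i)) (allFin 5)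

  E : Fin 21 → Fin 21 → Bool
  E u v = any (λ (a , b) → (a ≡ᵇ toℕ u) ∧ (b ≡ᵇ toℕ v)) edges

  adj₃ : Fin 21 → Fin 21 → Bool
  adj₃ u v = E u v ∨ E v u

  graph : Graph
  graph = record
    { n      = 21
    ; adj    = adj₃
    ; sym    = λ u v → ∨-comm (E u v) (E v u)
    ; irrefl = from-yes (all? λ v → adj₃ v v Bool.≟ false)
    }

  maxDegree : Δ graph ≡ 2 * (3 ∸ 1)
  maxDegree = refl

  triangle : Fin 3 → Fin 21
  triangle zero             = # 0
  triangle (suc zero)       = # 1
  triangle (suc (suc zero)) = # 6

  isClique : IsClique graph triangle
  isClique = from-yes (all? λ i → all? λ j → ¬? (i ≟ j) →-dec (adj₃ (triangle i) (triangle j) Bool.≟ true))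

  colouring : Colorable graph 3
  colouring = colour , from-yes (all? λ u → all? λ v → (adj₃ u v Bool.≟ true) →-dec ¬? (colour u ≟ colour v))
    where
    gadgetColour : Fin 8 → Fin 3
    gadgetColour v = [ (λ end → proj₂ (remQuot {3} 2 end) ↑ˡ 1) , (λ _ → # 2) ]′ (splitAt 6 v)
    colour : Fin 21 → Fin 3
    colour v = [ gadgetColour , [ gadgetColour , (λ _ → # 2) ]′ ∘ splitAt 8 ]′ (splitAt 8 v)

  list₃ : Fin 21 → List ℕ
  list₃ v = [ (λ _ → range 0 3) , [ (λ _ → range 3 3) , connectorList ]′ ∘ splitAt 8 ]′ (splitAt 8 v)

  lists : ListAssignment graph 3
  lists = list₃ , from-yes (all? λ v → unique? (list₃ v) ×-dec (length (list₃ v) ℕ.≟ 3))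

  connectorList-below : ∀ i → All.All (_< 6) (connectorList i)
  connectorList-below = from-yes (all? λ i → All.all? (ℕ._<? 6) (connectorList i))

  Separated : ℕ → ℕ → Set
  Separated a b = Σ (Fin 5) λ i → a ∉ connectorList i × b ∉ connectorList i

  separation : ∀ {a b} → a ∈ range 0 3 → b ∈ range 3 3 → Separated a b
  separation a∈ b∈ = All.lookup (All.lookup table a∈) b∈
    where
    separated? : ∀ a b → Dec (Separated a b)
    separated? a b = any? λ i → ¬? (a ∈? connectorList i) ×-dec ¬? (b ∈? connectorList i)
    table : All.All (λ a → All.All (Separated a) (range 3 3)) (range 0 3)
    table = from-yes (All.all? (λ a → All.all? (separated? a) (range 3 3)) (range 0 3))

  JoinedToEdge : Fin 21 → (Fin 2 → Fin 21) → Set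
  JoinedToEdge x edge = adj₃ x (edge zero) ≡ true × adj₃ x (edge (suc zero)) ≡ true

  attached : ∀ i → JoinedToEdge (connector i) (sEnd (proj₁ (attachment i)))
                 × JoinedToEdge (connector i) (tEnd (proj₂ (attachment i)))
  attached zero                         = (refl , refl) , (refl , refl)
  attached (suc zero)                   = (refl , refl) , (refl , refl)
  attached (suc (suc zero))             = (refl , refl) , (refl , refl)
  attached (suc (suc (suc zero)))       = (refl , refl) , (refl , refl)
  attached (suc (suc (suc (suc zero)))) = (refl , refl) , (refl , refl)

  module _ (c : Fin 21 → ℕ) (proper : Proper graph c) (c∈L : ∀ v → c v ∈ list₃ v) where

    edge-neighbours-agree : ∀ o {u u′ x y} → adj₃ u u′ ≡ true → adj₃ x u ≡ true → adj₃ x u′ ≡ true →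
                            adj₃ y u ≡ true → adj₃ y u′ ≡ true → c u ∈ range o 3 → c u′ ∈ range o 3 →
                            InWindow o 3 (c x) → c y ∈ range o 3 → c x ≡ c y
    edge-neighbours-agree o {u} {u′} u~u′ x~u x~u′ y~u y~u′ cu∈ cu′∈ x-window cy∈ =
      common-neighbours-of-clique-agree graph proper {w = w} edge window
        (λ { zero → x~u ; (suc zero) → x~u′ }) (λ { zero → y~u ; (suc zero) → y~u′ }) x-window (∈-range⁻ cy∈)
      where
      w : Fin 2 → Fin 21
      w zero       = u
      w (suc zero) = u′
      edge : IsClique graph w
      edge zero       zero       0≢0 = ⊥-elim (0≢0 refl)
      edge zero       (suc zero) _   = u~u′
      edge (suc zero) zero       _   = trans (∨-comm (E u′ u) (E u u′)) u~u′
      edge (suc zero) (suc zero) 1≢1 = ⊥-elim (1≢1 refl)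
      window : ∀ i → InWindow o 3 (c (w i))
      window zero       = ∈-range⁻ cu∈
      window (suc zero) = ∈-range⁻ cu′∈

    c7≡c6 : c (# 7) ≡ c (# 6)
    c7≡c6 = edge-neighbours-agree 0 refl refl refl refl refl
              (c∈L (# 2)) (c∈L (# 3)) (∈-range⁻ (c∈L (# 7))) (c∈L (# 6))

    c15≡c14 : c (# 15) ≡ c (# 14)
    c15≡c14 = edge-neighbours-agree 3 refl refl refl refl refl
                (c∈L (# 10)) (c∈L (# 11)) (∈-range⁻ (c∈L (# 15))) (c∈L (# 14))

    S-agree : ∀ e {x} → JoinedToEdge x (sEnd e) → c x < 3 → c x ≡ c (# 6)
    S-agree zero             (x~ , x~′) cx<3 =
      edge-neighbours-agree 0 refl x~ x~′ refl refl (c∈L (# 0)) (c∈L (# 1)) (z≤n , cx<3) (c∈L (# 6))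
    S-agree (suc zero)       (x~ , x~′) cx<3 =
      edge-neighbours-agree 0 refl x~ x~′ refl refl (c∈L (# 2)) (c∈L (# 3)) (z≤n , cx<3) (c∈L (# 6))
    S-agree (suc (suc zero)) (x~ , x~′) cx<3 =
      trans (edge-neighbours-agree 0 refl x~ x~′ refl refl (c∈L (# 4)) (c∈L (# 5)) (z≤n , cx<3) (c∈L (# 7)))
            c7≡c6

    T-agree : ∀ e {x} → JoinedToEdge x (tEnd e) → InWindow 3 3 (c x) → c x ≡ c (# 14)
    T-agree zero             (x~ , x~′) x-window =
      edge-neighbours-agree 3 refl x~ x~′ refl refl (c∈L (# 8)) (c∈L (# 9)) x-window (c∈L (# 14))
    T-agree (suc zero)       (x~ , x~′) x-window =
      edge-neighbours-agree 3 refl x~ x~′ refl refl (c∈L (# 10)) (c∈L (# 11)) x-window (c∈L (# 14))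
    T-agree (suc (suc zero)) (x~ , x~′) x-window =
      trans (edge-neighbours-agree 3 refl x~ x~′ refl refl (c∈L (# 12)) (c∈L (# 13)) x-window (c∈L (# 15)))
            c15≡c14

    connector-colour : ∀ i → c (connector i) ≡ c (# 6) ⊎ c (connector i) ≡ c (# 14)
    connector-colour i with <-≤-connex (c (connector i)) 3
    ... | inj₁ cx<3 = inj₁ (S-agree (proj₁ (attachment i)) (proj₁ (attached i)) cx<3)
    ... | inj₂ 3≤cx = inj₂ (T-agree (proj₂ (attachment i)) (proj₂ (attached i))
                             (3≤cx , All.lookup (connectorList-below i) (c∈L (connector i))))

    no-list-colouring : ⊥
    no-list-colouring with separation (c∈L (# 6)) (c∈L (# 14))
    ... | i , a∉ , b∉ = [ a∉ ∘ colour∈ , b∉ ∘ colour∈ ]′ (connector-colour i)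
      where
      colour∈ : ∀ {a} → c (connector i) ≡ a → a ∈ connectorList i
      colour∈ refl = c∈L (connector i)

  witness : Witness 3
  witness = record
    { graph           = graph
    ; clique          = triangle
    ; isClique        = isClique
    ; colouring       = colouring
    ; lists           = lists
    ; noListColouring = λ (c , proper , c∈L) → no-list-colouring c proper c∈L
    ; maxDegree       = maxDegree
    }

module Construction≥4 (p : ℕ) where

  q k : ℕ
  q = 3 + p
  k = suc q

  data Part : Set where
    inS inT : Fin q → Part
    inR     : Fin k → Part

  adjPart : Part → Part → Bool
  adjPart (inS i) (inS j) = not (does (i ≟ j))
  adjPart (inT i) (inT j) = not (does (i ≟ j))
  adjPart (inS _) (inR _) = true
  adjPart (inT _) (inR _) = true
  adjPart (inR _) (inS _) = true
  adjPart (inR _) (inT _) = true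
  adjPart _       _       = false

  ≢⇒adjacent : ∀ {m} {i j : Fin m} → i ≢ j → not (does (i ≟ j)) ≡ true
  ≢⇒adjacent {i = i} {j} i≢j = cong not (dec-false (i ≟ j) i≢j)

  adjacent⇒≢ : ∀ {m} (i j : Fin m) → not (does (i ≟ j)) ≡ true → i ≢ j
  adjacent⇒≢ i j adjacent with i ≟ j
  adjacent⇒≢ i j ()       | yes _
  adjacent⇒≢ i j _        | no i≢j = i≢j

  adjPart-sym : ∀ a b → adjPart a b ≡ adjPart b a
  adjPart-sym (inS i) (inS j) = cong not (does-⇔ (mk⇔ sym sym) (i ≟ j) (j ≟ i))
  adjPart-sym (inS i) (inT j) = refl
  adjPart-sym (inS i) (inR j) = refl
  adjPart-sym (inT i) (inS j) = refl
  adjPart-sym (inT i) (inT j) = cong not (does-⇔ (mk⇔ sym sym) (i ≟ j) (j ≟ i))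
  adjPart-sym (inT i) (inR j) = refl
  adjPart-sym (inR i) (inS j) = refl
  adjPart-sym (inR i) (inT j) = refl
  adjPart-sym (inR i) (inR j) = refl

  adjPart-irrefl : ∀ a → adjPart a a ≡ false
  adjPart-irrefl (inS i) = cong not (dec-true (i ≟ i) refl)
  adjPart-irrefl (inT i) = cong not (dec-true (i ≟ i) refl)
  adjPart-irrefl (inR j) = refl

  N : ℕ
  N = q + (q + k)

  part : Fin N → Part
  part v = [ inS , [ inT , inR ]′ ∘ splitAt q ]′ (splitAt q v)

  sv tv : Fin q → Fin N
  sv i = i ↑ˡ (q + k)
  tv i = q ↑ʳ (i ↑ˡ k)

  rv : Fin k → Fin N
  rv j = q ↑ʳ (q ↑ʳ j)

  part-sv : ∀ i → part (sv i) ≡ inS i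
  part-sv i rewrite splitAt-↑ˡ q i (q + k) = refl

  part-tv : ∀ i → part (tv i) ≡ inT i
  part-tv i rewrite splitAt-↑ʳ q (q + k) (i ↑ˡ k) | splitAt-↑ˡ q i k = refl

  part-rv : ∀ j → part (rv j) ≡ inR j
  part-rv j rewrite splitAt-↑ʳ q (q + k) (q ↑ʳ j) | splitAt-↑ʳ q k j = refl

  graph : Graph
  graph = record
    { n      = N
    ; adj    = λ u v → adjPart (part u) (part v)
    ; sym    = λ u v → adjPart-sym (part u) (part v)
    ; irrefl = λ v → adjPart-irrefl (part v)
    }

  adj-part : ∀ u v {a b} → part u ≡ a → part v ≡ b → adj graph u v ≡ adjPart a b
  adj-part u v refl refl = refl

  sv-clique : IsClique graph sv
  sv-clique i j i≢j = trans (adj-part (sv i) (sv j) (part-sv i) (part-sv j)) (≢⇒adjacent i≢j)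

  tv-clique : IsClique graph tv
  tv-clique i j i≢j = trans (adj-part (tv i) (tv j) (part-tv i) (part-tv j)) (≢⇒adjacent i≢j)

  rv~sv : ∀ j i → adj graph (rv j) (sv i) ≡ true
  rv~sv j i = adj-part (rv j) (sv i) (part-rv j) (part-sv i)

  rv~tv : ∀ j i → adj graph (rv j) (tv i) ≡ true
  rv~tv j i = adj-part (rv j) (tv i) (part-rv j) (part-tv i)

  neighbours-in-parts : Part → ℕ
  neighbours-in-parts a = trues (adjPart a ∘ inS) + (trues (adjPart a ∘ inT) + trues (adjPart a ∘ inR))

  degree-part : ∀ v → degree graph v ≡ neighbours-in-parts (part v)
  degree-part v = begin
    degree graph v                                      ≡⟨ length-filter-tabulate P (λ u → u) ⟩
    trues P                                             ≡⟨ trues-↑ q P ⟩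
    trues (P ∘ sv) + trues (P ∘ (q ↑ʳ_))                ≡⟨ cong (trues (P ∘ sv) +_) (trues-↑ q (P ∘ (q ↑ʳ_))) ⟩
    trues (P ∘ sv) + (trues (P ∘ tv) + trues (P ∘ rv))  ≡⟨ cong₂ _+_ (via sv part-sv)
                                                            (cong₂ _+_ (via tv part-tv) (via rv part-rv)) ⟩
    neighbours-in-parts (part v)                        ∎
    where
    open ≡-Reasoning
    P : Fin N → Bool
    P = adjPart (part v) ∘ part
    via : ∀ {m} (f : Fin m → Fin N) {g : Fin m → Part} → (∀ i → part (f i) ≡ g i) →
          trues (P ∘ f) ≡ trues (adjPart (part v) ∘ g)
    via f e = trues-cong (cong (adjPart (part v)) ∘ e)

  [q∸1]+k≡2*q : (q ∸ 1) + k ≡ 2 * q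
  [q∸1]+k≡2*q = trans (+-suc (q ∸ 1) q) (cong (q +_) (sym (+-identityʳ q)))

  neighbours-in-parts≡ : ∀ a → neighbours-in-parts a ≡ 2 * q
  neighbours-in-parts≡ (inS i) =
    trans (cong₂ _+_ (trues-≢ i) (cong₂ _+_ (trues-false q) (trues-true k))) [q∸1]+k≡2*q
  neighbours-in-parts≡ (inT i) =
    trans (cong₂ _+_ (trues-false q) (cong₂ _+_ (trues-≢ i) (trues-true k))) [q∸1]+k≡2*q
  neighbours-in-parts≡ (inR j) = cong₂ _+_ (trues-true q) (cong₂ _+_ (trues-true q) (trues-false k))

  maxDegree : Δ graph ≡ 2 * (k ∸ 1)
  maxDegree = foldr-⊔-constant (degree graph) zero (tabulate suc)
                (λ v → trans (degree-part v) (neighbours-in-parts≡ (part v)))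

  colourPart : Part → Fin k
  colourPart (inS i) = suc i
  colourPart (inT i) = suc i
  colourPart (inR _) = zero

  colourPart-proper : ∀ a b → adjPart a b ≡ true → colourPart a ≢ colourPart b
  colourPart-proper (inS i) (inS j) adjacent = adjacent⇒≢ i j adjacent ∘ suc-injective
  colourPart-proper (inT i) (inT j) adjacent = adjacent⇒≢ i j adjacent ∘ suc-injective
  colourPart-proper (inS _) (inR _) _ ()
  colourPart-proper (inT _) (inR _) _ ()
  colourPart-proper (inR _) (inS _) _ ()
  colourPart-proper (inR _) (inT _) _ ()
  colourPart-proper (inS _) (inT _) ()
  colourPart-proper (inT _) (inS _) ()
  colourPart-proper (inR _) (inR _) ()

  colouring : Colorable graph k
  colouring = colourPart ∘ part , λ u v → colourPart-proper (part u) (part v)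

  clique : Fin k → Fin N
  clique zero    = rv zero
  clique (suc i) = sv i

  isClique : IsClique graph clique
  isClique zero    zero    0≢0 = ⊥-elim (0≢0 refl)
  isClique zero    (suc j) _   = rv~sv zero j
  isClique (suc i) zero    _   = trans (Graph.sym graph (sv i) (rv zero)) (rv~sv zero i)
  isClique (suc i) (suc j) i≢j = sv-clique i j (i≢j ∘ cong suc)

  2≤k : 2 ≤ k
  2≤k = s≤s (s≤s z≤n)

  pairStart : Fin (2 + p) → ℕ
  pairStart zero    = 0
  pairStart (suc j) = 2 + toℕ j

  2+pairStart≤k : ∀ j → 2 + pairStart j ≤ k
  2+pairStart≤k zero    = 2≤k
  2+pairStart≤k (suc j) = s≤s (s≤s (s≤s (s≤s (ℕ.≤-pred (toℕ<n j)))))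

  pairList : ℕ → List ℕ
  pairList m = range 0 2 ++ range k m ++ range (k + (2 + m)) (k ∸ (2 + m))

  listR : Fin k → List ℕ
  listR zero          = range 2 k
  listR (suc zero)    = range 2 (2 + p) ++ range (2 + k) 2
  listR (suc (suc j)) = pairList (pairStart j)

  listPart : Part → List ℕ
  listPart (inS _) = range 0 k
  listPart (inT _) = range k k
  listPart (inR j) = listR j

  ∈-pairList-tail : ∀ {m x} → x ∈ range k m ++ range (k + (2 + m)) (k ∸ (2 + m)) →
                    k ≤ x × x ≢ k + m × x ≢ k + suc m
  ∈-pairList-tail {m} {x} x∈ with ∈-++⁻ (range k m) x∈
  ... | inj₁ x∈left with ∈-range⁻ x∈left
  ...   | k≤x , x<k+m = k≤x , <⇒≢ x<k+m , <⇒≢ (<-trans x<k+m (+-monoʳ-< k (ℕ.n<1+n m)))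
  ∈-pairList-tail {m} {x} x∈ | inj₂ x∈right with ∈-range⁻ x∈right
  ...   | k+2+m≤x , _ =
    ≤-trans (m≤m+n k (2 + m)) k+2+m≤x ,
    (λ { refl → <⇒≱ (+-monoʳ-< k (s≤s (m≤n+m m 1))) k+2+m≤x }) ,
    (λ { refl → <⇒≱ (+-monoʳ-< k (s≤s (s≤s ≤-refl))) k+2+m≤x })

  pairList-uniqueOfLength : ∀ {m} → 2 + m ≤ k → UniqueOfLength k (pairList m)
  pairList-uniqueOfLength {m} 2+m≤k =
    subst (λ l → UniqueOfLength l (pairList m)) (m+[n∸m]≡n 2+m≤k)
      (++-uniqueOfLength 2 (range-uniqueOfLength 0 2)
        (++-uniqueOfLength (k + m) (range-uniqueOfLength k m) (range-uniqueOfLength (k + (2 + m)) (k ∸ (2 + m)))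
          (proj₂ ∘ ∈-range⁻) (≤-trans (+-monoʳ-≤ k (m≤n+m m 2)) ∘ proj₁ ∘ ∈-range⁻))
        (proj₂ ∘ ∈-range⁻) (≤-trans 2≤k ∘ proj₁ ∘ ∈-pairList-tail {m}))

  listR-uniqueOfLength : ∀ j → UniqueOfLength k (listR j)
  listR-uniqueOfLength zero          = range-uniqueOfLength 2 k
  listR-uniqueOfLength (suc zero)    =
    subst (λ l → UniqueOfLength l (listR (suc zero))) (+-comm (2 + p) 2)
      (++-uniqueOfLength k (range-uniqueOfLength 2 (2 + p)) (range-uniqueOfLength (2 + k) 2)
        (proj₂ ∘ ∈-range⁻) (≤-trans (m≤n+m k 2) ∘ proj₁ ∘ ∈-range⁻))
  listR-uniqueOfLength (suc (suc j)) = pairList-uniqueOfLength (2+pairStart≤k j)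

  lists : ListAssignment graph k
  lists = listPart ∘ part , uniqueOfLength ∘ part
    where
    uniqueOfLength : ∀ a → UniqueOfLength k (listPart a)
    uniqueOfLength (inS _) = range-uniqueOfLength 0 k
    uniqueOfLength (inT _) = range-uniqueOfLength k k
    uniqueOfLength (inR j) = listR-uniqueOfLength j

  ∈-listR₁ : ∀ {x} → x ∈ listR (suc zero) → 2 ≤ x × (x < k ⊎ 2 + k ≤ x)
  ∈-listR₁ x∈ with ∈-++⁻ (range 2 (2 + p)) x∈
  ... | inj₁ x∈left  = map₂ inj₁ (∈-range⁻ x∈left)
  ... | inj₂ x∈right = ≤-trans (m≤m+n 2 k) (proj₁ (∈-range⁻ x∈right)) , inj₂ (proj₁ (∈-range⁻ x∈right))

  ∈-pairList : ∀ {m x} → x ∈ pairList m → x < 2 ⊎ (k ≤ x × x ≢ k + m × x ≢ k + suc m)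
  ∈-pairList x∈ with ∈-++⁻ (range 0 2) x∈
  ... | inj₁ x∈head = inj₁ (proj₂ (∈-range⁻ x∈head))
  ... | inj₂ x∈tail = inj₂ (∈-pairList-tail x∈tail)

  pairList-below : ∀ {m x} → 2 + m ≤ k → x ∈ pairList m → x < k + k
  pairList-below {m} 2+m≤k x∈ with ∈-++⁻ (range 0 2) x∈
  ... | inj₁ x∈head = <-≤-trans (proj₂ (∈-range⁻ x∈head)) (≤-trans 2≤k (m≤m+n k k))
  ... | inj₂ x∈tail with ∈-++⁻ (range k m) x∈tail
  ...   | inj₁ x∈left  = <-≤-trans (proj₂ (∈-range⁻ x∈left)) (+-monoʳ-≤ k (≤-trans (m≤n+m m 2) 2+m≤k))
  ...   | inj₂ x∈right = <-≤-trans (proj₂ (∈-range⁻ x∈right))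
                           (≤-reflexive (trans (+-assoc k (2 + m) _) (cong (k +_) (m+[n∸m]≡n 2+m≤k))))

  listR-below : ∀ j {x} → x ∈ listR j → x < k + k
  listR-below zero x∈ = <-≤-trans (proj₂ (∈-range⁻ x∈)) (+-monoˡ-≤ k 2≤k)
  listR-below (suc zero) x∈ with ∈-++⁻ (range 2 (2 + p)) x∈
  ... | inj₁ x∈left  = <-≤-trans (proj₂ (∈-range⁻ x∈left)) (m≤m+n k k)
  ... | inj₂ x∈right = <-≤-trans (proj₂ (∈-range⁻ x∈right))
                         (≤-trans (≤-reflexive (+-comm (2 + k) 2)) (+-monoˡ-≤ k (s≤s (s≤s (s≤s (s≤s z≤n))))))
  listR-below (suc (suc j)) x∈ = pairList-below (2+pairStart≤k j) x∈

  pairs-cover : ∀ u → u < k → Σ (Fin (2 + p)) λ j → u ≡ pairStart j ⊎ u ≡ suc (pairStart j)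
  pairs-cover zero          _                  = zero , inj₁ refl
  pairs-cover (suc zero)    _                  = zero , inj₂ refl
  pairs-cover (suc (suc u)) (s≤s (s≤s 1+u≤2+p)) with <-≤-connex u (suc p)
  ... | inj₁ u<1+p = suc (fromℕ< u<1+p) , inj₁ (cong (2 +_) (sym (toℕ-fromℕ< u<1+p)))
  ... | inj₂ 1+p≤u = suc (fromℕ p) , inj₂ (cong (2 +_) (trans u≡1+p (cong suc (sym (toℕ-fromℕ p)))))
    where
    u≡1+p : u ≡ suc p
    u≡1+p = ℕ.≤-antisym (ℕ.≤-pred 1+u≤2+p) 1+p≤u

  module _ (c : Fin N → ℕ) (proper : Proper graph c) (c∈L : ∀ v → c v ∈ listPart (part v)) where

    c∈ : ∀ {v a} → part v ≡ a → c v ∈ listPart a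
    c∈ {v} e = subst (λ a → c v ∈ listPart a) e (c∈L v)

    colR : Fin k → ℕ
    colR j = c (rv j)

    colR∈ : ∀ j → colR j ∈ listR j
    colR∈ j = c∈ (part-rv j)

    low-colours-agree : ∀ j j′ → colR j < k → colR j′ < k → colR j ≡ colR j′
    low-colours-agree j j′ lo lo′ =
      common-neighbours-of-clique-agree graph proper {w = sv} sv-clique (λ i → ∈-range⁻ (c∈ (part-sv i)))
        (rv~sv j) (rv~sv j′) (z≤n , lo) (z≤n , lo′)

    high-colours-agree : ∀ j j′ → k ≤ colR j → k ≤ colR j′ → colR j ≡ colR j′
    high-colours-agree j j′ hi hi′ =
      common-neighbours-of-clique-agree graph proper {w = tv} tv-clique (λ i → ∈-range⁻ (c∈ (part-tv i)))
        (rv~tv j) (rv~tv j′) (hi , listR-below j (colR∈ j)) (hi′ , listR-below j′ (colR∈ j′))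

    colour-between-2-and-k : Σ (Fin k) λ j → 2 ≤ colR j × colR j < k
    colour-between-2-and-k with ∈-range⁻ (colR∈ zero) | <-≤-connex (colR zero) k
    ... | 2≤x₀ , _      | inj₁ x₀<k = zero , 2≤x₀ , x₀<k
    ... | _    , x₀<2+k | inj₂ k≤x₀ with ∈-listR₁ (colR∈ (suc zero))
    ...   | 2≤x₁ , inj₁ x₁<k   = suc zero , 2≤x₁ , x₁<k
    ...   | _    , inj₂ 2+k≤x₁ = ⊥-elim (<⇒≱ x₀<2+k (≤-trans 2+k≤x₁ (≤-reflexive (sym
                                   (high-colours-agree zero (suc zero) k≤x₀ (≤-trans (m≤n+m k 2) 2+k≤x₁))))))

    pair-colour-avoids : ∀ j → k ≤ colR (suc (suc j)) × colR (suc (suc j)) ≢ k + pairStart j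
                                                     × colR (suc (suc j)) ≢ k + suc (pairStart j)
    pair-colour-avoids j with ∈-pairList (colR∈ (suc (suc j)))
    ... | inj₂ avoids = avoids
    ... | inj₁ x<2 with colour-between-2-and-k
    ...   | i , 2≤y , y<k = ⊥-elim (<⇒≱ x<2 (≤-trans 2≤y (≤-reflexive
                              (low-colours-agree i (suc (suc j)) y<k (<-≤-trans x<2 2≤k)))))

    no-list-colouring : ⊥
    no-list-colouring = t-not-in-any-pair (pairs-cover (t ∸ k) t∸k<k)
      where
      t : ℕ
      t = colR (suc (suc zero))
      k≤t : k ≤ t
      k≤t = proj₁ (pair-colour-avoids zero)
      t∸k<k : t ∸ k < k
      t∸k<k = <-≤-trans (∸-monoˡ-< (listR-below (suc (suc zero)) (colR∈ (suc (suc zero)))) k≤t)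
                        (≤-reflexive (m+n∸m≡n k k))
      colour≡k+[t∸k] : ∀ j → colR (suc (suc j)) ≡ k + (t ∸ k)
      colour≡k+[t∸k] j =
        trans (high-colours-agree (suc (suc j)) (suc (suc zero)) (proj₁ (pair-colour-avoids j)) k≤t)
              (sym (m+[n∸m]≡n k≤t))
      t-not-in-any-pair : (Σ (Fin (2 + p)) λ j → t ∸ k ≡ pairStart j ⊎ t ∸ k ≡ suc (pairStart j)) → ⊥
      t-not-in-any-pair (j , inj₁ e) =
        proj₁ (proj₂ (pair-colour-avoids j)) (trans (colour≡k+[t∸k] j) (cong (k +_) e))
      t-not-in-any-pair (j , inj₂ e) =
        proj₂ (proj₂ (pair-colour-avoids j)) (trans (colour≡k+[t∸k] j) (cong (k +_) e))

  witness : Witness k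
  witness = record
    { graph           = graph
    ; clique          = clique
    ; isClique        = isClique
    ; colouring       = colouring
    ; lists           = lists
    ; noListColouring = λ (c , proper , c∈L) → no-list-colouring c proper c∈L
    ; maxDegree       = maxDegree
    }

mainTheorem10 : (k : ℕ) → 3 ≤ k →
    Σ Graph (λ G → IsChromaticNumber G k
                 × (∀ m → Choosable G m → k < m)
                 × Δ G ≡ 2 * (k ∸ 1))
mainTheorem10 (suc (suc (suc zero)))    _ = witness⇒choosability-gap Construction3.witness
mainTheorem10 (suc (suc (suc (suc p)))) _ = witness⇒choosability-gap (Construction≥4.witness p)
mainTheorem10 (suc zero)                (s≤s ())
mainTheorem10 (suc (suc zero))          (s≤s (s≤s ()))
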